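{- For (finite) $\pi$-calculus processes $P$ and $Q$: $P\mathrel{\sim_L}Q$ (late equivalence) if and only if for every $\mathcal{OM}$ formula $\phi$, $P\mathrel{\vDash_L}\phi$ iff $Q\mathrel{\vDash_L}\phi$.
   Context: Names range over a countably infinite set; distinct names are regarded as distinct. Actions: $\pi ::= \tau \mid \overline{x}z \mid \overline{x}(z) \mid x(z)$. Processes: $P ::= 0 \mid \nu x.P \mid \pi.P \mid [x=y]P \mid P \| P \mid P + P$, with $\nu x.P$, $z(x).P$, $\overline{z}(x).P$ binding $x$ in $P$, up to $\alpha$-conversion. $\mathrm{n}(x(y))=\mathrm{n}(\overline{x}(y))=\mathrm{n}(\overline{x}y)=\{x,y\}$, $\mathrm{bn}(x(y))=\mathrm{bn}(\overline{x}(y))=\{y\}$, $\mathrm{n}(\tau)=\mathrm{bn}(\tau)=\mathrm{bn}(\overline{x}y)=\emptyset$. The late transition relation $P\xrightarrow{\pi}Q$ is the least relation closed under: $\pi.P \xrightarrow{\pi} P$; if $P\xrightarrow{\overline{x}z}Q$ and $x\neq z$ then $\nu z.P \xrightarrow{\overline{x}(z)} Q$; if $P\xrightarrow{\pi}R$ then $P+Q\xrightarrow{\pi}R$ and $Q+P\xrightarrow{\pi}R$; if $P\xrightarrow{\pi}R$ then $[x=x]P\xrightarrow{\pi}R$; if $P\xrightarrow{\pi}Q$ and $x\notin\mathrm{n}(\pi)$ then $\nu x.P\xrightarrow{\pi}\nu x.Q$; if $P\xrightarrow{\pi}Q$ and $\mathrm{bn}(\pi)$ is fresh for $R$ then $P\|R\xrightarrow{\pi}Q\|R$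 and $R\|P\xrightarrow{\pi}R\|Q$; if $P\xrightarrow{\overline{x}(z)}P'$ and $Q\xrightarrow{x(z)}Q'$ then $P\|Q\xrightarrow{\tau}\nu z.(P'\|Q')$ and symmetrically; if $P\xrightarrow{\overline{x}y}P'$ and $Q\xrightarrow{x(z)}Q'$ then $P\|Q\xrightarrow{\tau}P'\|Q'\{y/z\}$ and symmetrically. Substitutions $\sigma$ are maps from names to names, applied capture-avoidingly. Late bisimulation: a symmetric relation $\mathcal{R}$ such that whenever $P\,\mathcal{R}\,Q$: if $P\xrightarrow{\alpha}P'$ ($\alpha$ being $\tau$ or $\overline{a}b$) then $Q\xrightarrow{\alpha}Q'$ for some $Q'$ with $P'\,\mathcal{R}\,Q'$; if $P\xrightarrow{\overline{a}(x)}P'$ ($x$ fresh) then $Q\xrightarrow{\overline{a}(x)}Q'$ with $P'\,\mathcal{R}\,Q'$; if $P\xrightarrow{a(x)}P'$ ($x$ fresh) then $Q\xrightarrow{a(x)}Q'$ for some $Q'$ such that for all names $y$, $P'\{y/x\}\,\mathcal{R}\,Q'\{y/x\}$. Late equivalence: $P\mathrel{\sim_L}Q$ iff there is a late bisimulation $\mathcal{R}$ with $P\sigma\,\mathcal{R}\,Q\sigma$ for all substitutions $\sigma$. $\mathcal{OM}$ formulae: $\phi ::= \mathtt{tt}\mid\mathtt{ff}\mid\phi\wedge\phi\mid\phi\vee\phi\mid\phi\supset\phi\mid x=y\mid\langle\pi\rangle\phi\mid[\pi]\phi$ ($z$ bound in $\phi$ for modalities labelled $\overline{a}(z)$ or $a(z)$).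 Classical semantics $P\mathrel{\dot\vDash_L}\phi$: $\mathtt{tt}$ and $x=x$ always hold; $\mathtt{ff}$ never holds and $x=y$ fails for distinct names; $\wedge,\vee$ pointwise; $\phi_1\supset\phi_2$ holds iff $P\mathrel{\dot\vDash_L}\phi_1$ implies $P\mathrel{\dot\vDash_L}\phi_2$; for $\alpha$ being $\tau$, $\overline{a}b$ or $\overline{a}(z)$: $P\mathrel{\dot\vDash_L}\langle\alpha\rangle\phi$ iff $\exists Q$, $P\xrightarrow{\alpha}Q$ and $Q\mathrel{\dot\vDash_L}\phi$, and $P\mathrel{\dot\vDash_L}[\alpha]\phi$ iff for all $Q$ with $P\xrightarrow{\alpha}Q$, $Q\mathrel{\dot\vDash_L}\phi$; $P\mathrel{\dot\vDash_L}\langle a(z)\rangle\phi$ iff $\exists Q$, $P\xrightarrow{a(z)}Q$ and for all names $y$, $Q\{y/z\}\mathrel{\dot\vDash_L}\phi\{y/z\}$; $P\mathrel{\dot\vDash_L}[a(z)]\phi$ iff for all $Q$ with $P\xrightarrow{a(z)}Q$ and all names $y$, $Q\{y/z\}\mathrel{\dot\vDash_L}\phi\{y/z\}$. Finally $P\mathrel{\vDash_L}\phi$ iff for all substitutions $\sigma$, $P\sigma\mathrel{\dot\vDash_L}\phi\sigma$. -}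

module Defs where

-- Finite pi-calculus (late semantics) and the modal logic OM,
-- using de Bruijn indices for names (binding up to alpha-conversion).
-- Names are natural numbers; a binder binds index 0 and shifts the others.

open import Data.Nat using (ℕ; zero; suc)
open import Data.Product using (Σ; _×_; _,_; ∃)
open import Data.Sum using (_⊎_)
open import Data.Unit using (⊤)
open import Data.Empty using (⊥)
open import Level using (Level) renaming (suc to lsuc; zero to lzero)
open import Relation.Binary.PropositionalEquality using (_≡_)

Ren : Set
Ren = ℕ → ℕ

ext : Ren → Ren
ext ρ zero    = zero
ext ρ (suc n) = suc (ρ n)

sub0 : ℕ → Ren
sub0 y zero    = y
sub0 y (suc n) = n

swap : Ren
swap zero          = suc zero
swap (suc zero)    = zero
swap (suc (suc n)) = suc (suc n)

-- Actions  π ::= τ | x̄z | x̄(z) | x(z)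
-- For the bound actions x̄(z) and x(z) the bound name z is the new
-- de Bruijn index 0 of whatever follows the action.

data Act : Set where
  τa    : Act
  outa  : ℕ → ℕ → Act
  bouta : ℕ → Act
  inpa  : ℕ → Act

renA : Ren → Act → Act
renA ρ τa         = τa
renA ρ (outa x z) = outa (ρ x) (ρ z)
renA ρ (bouta x)  = bouta (ρ x)
renA ρ (inpa x)   = inpa (ρ x)

extA : Act → Ren → Ren
extA τa         ρ = ρ
extA (outa _ _) ρ = ρ
extA (bouta _)  ρ = ext ρ
extA (inpa _)   ρ = ext ρ

infixr 6 _∙_
infixl 4 _∥_ _⊕_

data Proc : Set where
  𝟘     : Proc
  ν     : Proc → Proc
  _∙_   : Act → Proc → Proc
  match : ℕ → ℕ → Proc → Proc
  _∥_   : Proc → Proc → Proc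
  _⊕_   : Proc → Proc → Proc

ren : Ren → Proc → Proc
ren ρ 𝟘             = 𝟘
ren ρ (ν P)         = ν (ren (ext ρ) P)
ren ρ (α ∙ P)       = renA ρ α ∙ ren (extA α ρ) P
ren ρ (match x y P) = match (ρ x) (ρ y) (ren ρ P)
ren ρ (P ∥ Q)       = ren ρ P ∥ ren ρ Q
ren ρ (P ⊕ Q)       = ren ρ P ⊕ ren ρ Q

-- a process put next to a bound action must not capture the bound name
bump : Act → Proc → Proc
bump τa         R = R
bump (outa _ _) R = R
bump (bouta _)  R = ren suc R
bump (inpa _)   R = ren suc R

infix 3 _—[_]→_

data _—[_]→_ : Proc → Act → Proc → Set where
  pre     : ∀ {α P} → α ∙ P —[ α ]→ P
  open'   : ∀ {P Q x} → P —[ outa (suc x) zero ]→ Q → ν P —[ bouta x ]→ Q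
  sum-l   : ∀ {P Q R α} → P —[ α ]→ R → P ⊕ Q —[ α ]→ R
  sum-r   : ∀ {P Q R α} → P —[ α ]→ R → Q ⊕ P —[ α ]→ R
  mat     : ∀ {P R α x} → P —[ α ]→ R → match x x P —[ α ]→ R
  res-τ   : ∀ {P Q} → P —[ τa ]→ Q → ν P —[ τa ]→ ν Q
  res-out : ∀ {P Q a b} → P —[ outa (suc a) (suc b) ]→ Q → ν P —[ outa a b ]→ ν Q
  res-bout : ∀ {P Q a} → P —[ bouta (suc a) ]→ Q → ν P —[ bouta a ]→ ν (ren swap Q)
  res-inp : ∀ {P Q a} → P —[ inpa (suc a) ]→ Q → ν P —[ inpa a ]→ ν (ren swap Q)
  par-l   : ∀ {P Q R α} → P —[ α ]→ Q → P ∥ R —[ α ]→ Q ∥ bump α R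
  par-r   : ∀ {P Q R α} → P —[ α ]→ Q → R ∥ P —[ α ]→ bump α R ∥ Q
  close-l : ∀ {P P' Q Q' x} → P —[ bouta x ]→ P' → Q —[ inpa x ]→ Q' →
            P ∥ Q —[ τa ]→ ν (P' ∥ Q')
  close-r : ∀ {P P' Q Q' x} → P —[ bouta x ]→ P' → Q —[ inpa x ]→ Q' →
            Q ∥ P —[ τa ]→ ν (Q' ∥ P')
  comm-l  : ∀ {P P' Q Q' x y} → P —[ outa x y ]→ P' → Q —[ inpa x ]→ Q' →
            P ∥ Q —[ τa ]→ P' ∥ ren (sub0 y) Q'
  comm-r  : ∀ {P P' Q Q' x y} → P —[ outa x y ]→ P' → Q —[ inpa x ]→ Q' →
            Q ∥ P —[ τa ]→ ren (sub0 y) Q' ∥ P'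

record LateBisim (R : Proc → Proc → Set) : Set where
  field
    symm     : ∀ {P Q} → R P Q → R Q P
    sim-τ    : ∀ {P Q P'} → R P Q → P —[ τa ]→ P' →
               ∃ λ Q' → (Q —[ τa ]→ Q') × R P' Q'
    sim-out  : ∀ {P Q P' a b} → R P Q → P —[ outa a b ]→ P' →
               ∃ λ Q' → (Q —[ outa a b ]→ Q') × R P' Q'
    sim-bout : ∀ {P Q P' a} → R P Q → P —[ bouta a ]→ P' →
               ∃ λ Q' → (Q —[ bouta a ]→ Q') × R P' Q'
    sim-inp  : ∀ {P Q P' a} → R P Q → P —[ inpa a ]→ P' →
               ∃ λ Q' → (Q —[ inpa a ]→ Q') ×
                        (∀ y → R (ren (sub0 y) P') (ren (sub0 y) Q'))

infix 2 _∼L_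
_∼L_ : Proc → Proc → Set₁
P ∼L Q = Σ (Proc → Proc → Set) λ R →
           LateBisim R × (∀ (σ : Ren) → R (ren σ P) (ren σ Q))

infixr 5 _∧_ _∨_
infixr 4 _⊃_

data Form : Set where
  tt ff   : Form
  _∧_ _∨_ _⊃_ : Form → Form → Form
  _≐_     : ℕ → ℕ → Form
  ⟨_⟩_    : Act → Form → Form
  [_]_    : Act → Form → Form

renF : Ren → Form → Form
renF ρ tt        = tt
renF ρ ff        = ff
renF ρ (φ ∧ ψ)   = renF ρ φ ∧ renF ρ ψ
renF ρ (φ ∨ ψ)   = renF ρ φ ∨ renF ρ ψ
renF ρ (φ ⊃ ψ)   = renF ρ φ ⊃ renF ρ ψ
renF ρ (x ≐ y)   = ρ x ≐ ρ y
renF ρ (⟨ α ⟩ φ) = ⟨ renA ρ α ⟩ renF (extA α ρ) φ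
renF ρ ([ α ] φ) = [ renA ρ α ] renF (extA α ρ) φ

-- y ∷ρ ρ  =  sub0 y ∘ ext ρ
_∷ρ_ : ℕ → Ren → Ren
(y ∷ρ ρ) zero    = y
(y ∷ρ ρ) (suc n) = ρ n

-- sat P ρ φ  means  P ⊨̇ φρ  (the classical satisfaction of the formula
-- φ with the substitution ρ applied to it).  Carrying ρ as a parameter
-- makes the definition structurally recursive on φ.
sat : Proc → Ren → Form → Set
sat P ρ tt        = ⊤
sat P ρ ff        = ⊥
sat P ρ (φ ∧ ψ)   = sat P ρ φ × sat P ρ ψ
sat P ρ (φ ∨ ψ)   = sat P ρ φ ⊎ sat P ρ ψ
sat P ρ (φ ⊃ ψ)   = sat P ρ φ → sat P ρ ψ
sat P ρ (x ≐ y)   = ρ x ≡ ρ y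
sat P ρ (⟨ τa ⟩ φ)       = ∃ λ Q → (P —[ τa ]→ Q) × sat Q ρ φ
sat P ρ (⟨ outa a b ⟩ φ) = ∃ λ Q → (P —[ outa (ρ a) (ρ b) ]→ Q) × sat Q ρ φ
sat P ρ (⟨ bouta a ⟩ φ)  = ∃ λ Q → (P —[ bouta (ρ a) ]→ Q) × sat Q (ext ρ) φ
sat P ρ (⟨ inpa a ⟩ φ)   = ∃ λ Q → (P —[ inpa (ρ a) ]→ Q) ×
                             (∀ y → sat (ren (sub0 y) Q) (y ∷ρ ρ) φ)
sat P ρ ([ τa ] φ)       = ∀ Q → P —[ τa ]→ Q → sat Q ρ φ
sat P ρ ([ outa a b ] φ) = ∀ Q → P —[ outa (ρ a) (ρ b) ]→ Q → sat Q ρ φ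
sat P ρ ([ bouta a ] φ)  = ∀ Q → P —[ bouta (ρ a) ]→ Q → sat Q (ext ρ) φ
sat P ρ ([ inpa a ] φ)   = ∀ Q → P —[ inpa (ρ a) ]→ Q →
                             ∀ y → sat (ren (sub0 y) Q) (y ∷ρ ρ) φ

infix 2 _⊨̇_ _⊨_
_⊨̇_ : Proc → Form → Set
P ⊨̇ φ = sat P (λ n → n) φ

_⊨_ : Proc → Form → Set
P ⊨ φ = ∀ (σ : Ren) → ren σ P ⊨̇ renF σ φ

-- Soundness: satisfaction of OM formulae is invariant under any relation between
-- process–environment pairs that is symmetric, respects equality of names and matches
-- transitions (SatTransfer). A late bisimulation with equal environments is such a relation,
-- and so is a bijective renaming of names.
--
-- Completeness: logical equivalence (agreement on all formulae under every environment) is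
-- itself a late bisimulation. Processes are finite-branching and transitions decrease size, so
-- by well-founded recursion each pair is either logically equivalent or distinguished by a
-- formula: the conjunction of formulae separating a transition from each of its candidate
-- matches. For an input only finitely many received names need comparing, since the instances
-- at fresh names differ by a transposition, which preserves satisfaction. Finally P ⊨ φ
-- quantifies over all substitutions, so a formula distinguishing Pσ from Qσ is turned into one
-- distinguishing P from Q by guarding it with a formula recording which names σ identifies:
-- any substitution satisfying the guard is, on the relevant names, a bijective renaming of a
-- fixed substitution that agrees with σ on the names of P and Q.

module Submission where

open import Defs
open import Data.Empty using (⊥-elim)
open import Data.List using (List; []; _∷_; _++_; map; concat; concatMap; cartesianProductWith)
open import Data.List.Membership.Propositional using (_∈_)
open import Data.List.Membership.Propositional.Properties
  using (∈-map⁺; ∈-++⁺ˡ; ∈-++⁺ʳ; ∈-concat⁺′; ∈-cartesianProductWith⁺)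
open import Data.List.Relation.Unary.All using (All; []; _∷_)
import Data.List.Relation.Unary.All as All
open import Data.List.Relation.Unary.All.Properties using () renaming (map⁺ to All-map⁺)
open import Data.List.Relation.Unary.Any using (Any; here; there; satisfied)
open import Data.Nat using (ℕ; zero; suc; _+_; _∸_; _⊔_; _≤_; _<_; z≤n; s≤s; _≟_; _<?_)
open import Data.Nat.Induction using (<-wellFounded)
open import Data.Nat.Properties
  using ( ≤-refl; <-trans; <-≤-trans; n≤1+n; n<1+n; m<n⇒m<1+n; m<1+n⇒m<n∨m≡n; ≮⇒≥; <⇒≢; <⇒≱
        ; m≤m⊔n; m≤n⊔m; m≤m+n; m≤n+m; +-suc; +-comm; m+n∸m≡n
        ; +-mono-≤; +-mono-<; +-monoˡ-<; +-monoʳ-< )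
open import Data.Product using (Σ; ∃; _×_; _,_; proj₁; proj₂)
open import Data.Product.Function.NonDependent.Propositional using (_×-⇔_)
open import Data.Product.Properties using (≡-dec)
open import Data.Sum using (_⊎_; inj₁; inj₂; [_,_]′)
import Data.Sum as Sum
open import Data.Sum.Function.Propositional using (_⊎-⇔_)
open import Data.Unit using () renaming (tt to ⋆)
open import Function using (_∘_; id; _⇔_; mk⇔; Equivalence; _↔_; mk↔ₛ′; Inverse)
open import Function.Construct.Composition using (_↔-∘_)
open import Function.Construct.Identity using (⇔-id; ↔-id)
open import Function.Construct.Symmetry using (↔-sym; ⇔-sym)
open import Function.Properties.Equivalence using () renaming (trans to ⇔-trans)
open import Function.Related.TypeIsomorphisms using (→-cong-⇔)
open import Induction.WellFounded using (Acc; acc)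
open import Relation.Binary.Definitions using (DecidableEquality)
open import Relation.Binary.PropositionalEquality
  using (_≡_; _≢_; refl; sym; trans; cong; cong₂; subst; subst₂; _≗_; ≡-≟-identity)
open import Relation.Nullary using (¬_; Dec; yes; no)
open import Relation.Nullary.Decidable using (map′; toSum)

open Equivalence using (to; from)
open Inverse using (strictlyInverseˡ; strictlyInverseʳ)

-- Renaming

ext-∘ : ∀ {ρ σ τ} → ρ ∘ σ ≗ τ → ext ρ ∘ ext σ ≗ ext τ
ext-∘ e zero    = refl
ext-∘ e (suc n) = cong suc (e n)

extA-∘ : ∀ {ρ σ τ} α → ρ ∘ σ ≗ τ → extA (renA σ α) ρ ∘ extA α σ ≗ extA α τ
extA-∘ τa         e = e
extA-∘ (outa _ _) e = e
extA-∘ (bouta _)  e = ext-∘ e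
extA-∘ (inpa _)   e = ext-∘ e

renA-∘ : ∀ {ρ σ τ} → ρ ∘ σ ≗ τ → ∀ α → renA ρ (renA σ α) ≡ renA τ α
renA-∘ e τa         = refl
renA-∘ e (outa x z) = cong₂ outa (e x) (e z)
renA-∘ e (bouta x)  = cong bouta (e x)
renA-∘ e (inpa x)   = cong inpa (e x)

match-cong : ∀ {x x′ y y′ P P′} → x ≡ x′ → y ≡ y′ → P ≡ P′ → match x y P ≡ match x′ y′ P′
match-cong refl refl refl = refl

ren-∘ : ∀ {ρ σ τ} → ρ ∘ σ ≗ τ → ∀ P → ren ρ (ren σ P) ≡ ren τ P
ren-∘ e 𝟘             = refl
ren-∘ e (ν P)         = cong ν (ren-∘ (ext-∘ e) P)
ren-∘ e (α ∙ P)       = cong₂ _∙_ (renA-∘ e α) (ren-∘ (extA-∘ α e) P)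
ren-∘ e (match x y P) = match-cong (e x) (e y) (ren-∘ e P)
ren-∘ e (P ∥ Q)       = cong₂ _∥_ (ren-∘ e P) (ren-∘ e Q)
ren-∘ e (P ⊕ Q)       = cong₂ _⊕_ (ren-∘ e P) (ren-∘ e Q)

ren-square : ∀ {ρ σ ρ′ σ′} → ρ ∘ σ ≗ ρ′ ∘ σ′ → ∀ P → ren ρ (ren σ P) ≡ ren ρ′ (ren σ′ P)
ren-square e P = trans (ren-∘ e P) (sym (ren-∘ (λ _ → refl) P))

ext-≗id : ∀ {ρ} → ρ ≗ id → ext ρ ≗ id
ext-≗id e zero    = refl
ext-≗id e (suc n) = cong suc (e n)

extA-≗id : ∀ {ρ} α → ρ ≗ id → extA α ρ ≗ id
extA-≗id τa         e = e
extA-≗id (outa _ _) e = e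
extA-≗id (bouta _)  e = ext-≗id e
extA-≗id (inpa _)   e = ext-≗id e

renA-≗id : ∀ {ρ} → ρ ≗ id → ∀ α → renA ρ α ≡ α
renA-≗id e τa         = refl
renA-≗id e (outa x z) = cong₂ outa (e x) (e z)
renA-≗id e (bouta x)  = cong bouta (e x)
renA-≗id e (inpa x)   = cong inpa (e x)

ren-≗id : ∀ {ρ} → ρ ≗ id → ∀ P → ren ρ P ≡ P
ren-≗id e 𝟘             = refl
ren-≗id e (ν P)         = cong ν (ren-≗id (ext-≗id e) P)
ren-≗id e (α ∙ P)       = cong₂ _∙_ (renA-≗id e α) (ren-≗id (extA-≗id α e) P)
ren-≗id e (match x y P) = match-cong (e x) (e y) (ren-≗id e P)
ren-≗id e (P ∥ Q)       = cong₂ _∥_ (ren-≗id e P) (ren-≗id e Q)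
ren-≗id e (P ⊕ Q)       = cong₂ _⊕_ (ren-≗id e P) (ren-≗id e Q)

bump-ren : ∀ σ α R → bump (renA σ α) (ren σ R) ≡ ren (extA α σ) (bump α R)
bump-ren σ τa         R = refl
bump-ren σ (outa _ _) R = refl
bump-ren σ (bouta _)  R = ren-square (λ _ → refl) R
bump-ren σ (inpa _)   R = ren-square (λ _ → refl) R

swap-natural : ∀ σ → swap ∘ ext (ext σ) ≗ ext (ext σ) ∘ swap
swap-natural σ zero          = refl
swap-natural σ (suc zero)    = refl
swap-natural σ (suc (suc n)) = refl

sub0-natural : ∀ σ y → sub0 (σ y) ∘ ext σ ≗ σ ∘ sub0 y
sub0-natural σ y zero    = refl
sub0-natural σ y (suc n) = refl

retarget : ∀ {P α Q Q′} → Q ≡ Q′ → P —[ α ]→ Q → P —[ α ]→ Q′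
retarget refl d = d

step-ren : ∀ σ {P α Q} → P —[ α ]→ Q → ren σ P —[ renA σ α ]→ ren (extA α σ) Q
step-ren σ pre       = pre
step-ren σ (open' d) = open' (step-ren (ext σ) d)
step-ren σ (sum-l d) = sum-l (step-ren σ d)
step-ren σ (sum-r d) = sum-r (step-ren σ d)
step-ren σ (mat d)   = mat (step-ren σ d)
step-ren σ (res-τ d)   = res-τ (step-ren (ext σ) d)
step-ren σ (res-out d) = res-out (step-ren (ext σ) d)
step-ren σ (res-bout {Q = Q} d) =
  retarget (cong ν (ren-square (swap-natural σ) Q)) (res-bout (step-ren (ext σ) d))
step-ren σ (res-inp {Q = Q} d) =
  retarget (cong ν (ren-square (swap-natural σ) Q)) (res-inp (step-ren (ext σ) d))
step-ren σ (par-l {R = R} {α} d) =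
  retarget (cong (_ ∥_) (bump-ren σ α R)) (par-l (step-ren σ d))
step-ren σ (par-r {R = R} {α} d) =
  retarget (cong (_∥ _) (bump-ren σ α R)) (par-r (step-ren σ d))
step-ren σ (close-l d e) = close-l (step-ren σ d) (step-ren σ e)
step-ren σ (close-r d e) = close-r (step-ren σ d) (step-ren σ e)
step-ren σ (comm-l {Q' = Q′} {y = y} d e) =
  retarget (cong (_ ∥_) (ren-square (sub0-natural σ y) Q′)) (comm-l (step-ren σ d) (step-ren σ e))
step-ren σ (comm-r {Q' = Q′} {y = y} d e) =
  retarget (cong (_∥ _) (ren-square (sub0-natural σ y) Q′)) (comm-r (step-ren σ d) (step-ren σ e))

size : Proc → ℕ
size 𝟘             = 0
size (ν P)         = suc (size P)
size (α ∙ P)       = suc (size P)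
size (match x y P) = suc (size P)
size (P ∥ Q)       = suc (size P + size Q)
size (P ⊕ Q)       = suc (size P + size Q)

size-ren : ∀ ρ P → size (ren ρ P) ≡ size P
size-ren ρ 𝟘             = refl
size-ren ρ (ν P)         = cong suc (size-ren (ext ρ) P)
size-ren ρ (α ∙ P)       = cong suc (size-ren (extA α ρ) P)
size-ren ρ (match x y P) = cong suc (size-ren ρ P)
size-ren ρ (P ∥ Q)       = cong suc (cong₂ _+_ (size-ren ρ P) (size-ren ρ Q))
size-ren ρ (P ⊕ Q)       = cong suc (cong₂ _+_ (size-ren ρ P) (size-ren ρ Q))

size-bump : ∀ α R → size (bump α R) ≡ size R
size-bump τa         R = refl
size-bump (outa _ _) R = refl
size-bump (bouta _)  R = size-ren suc R
size-bump (inpa _)   R = size-ren suc R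

step-size : ∀ {P α Q} → P —[ α ]→ Q → size Q < size P
step-size pre = n<1+n _
step-size (open' d) = m<n⇒m<1+n (step-size d)
step-size (sum-l {P = P} {Q} d) = m<n⇒m<1+n (<-≤-trans (step-size d) (m≤m+n (size P) (size Q)))
step-size (sum-r {P = P} {Q} d) = m<n⇒m<1+n (<-≤-trans (step-size d) (m≤n+m (size P) (size Q)))
step-size (mat d) = m<n⇒m<1+n (step-size d)
step-size (res-τ d) = s≤s (step-size d)
step-size (res-out d) = s≤s (step-size d)
step-size (res-bout {Q = Q} d) = s≤s (subst (_< _) (sym (size-ren swap Q)) (step-size d))
step-size (res-inp {Q = Q} d) = s≤s (subst (_< _) (sym (size-ren swap Q)) (step-size d))
step-size (par-l {R = R} {α} d) =
  s≤s (subst (λ r → _ + r < _) (sym (size-bump α R)) (+-monoˡ-< (size R) (step-size d)))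
step-size (par-r {R = R} {α} d) =
  s≤s (subst (λ r → r + _ < _) (sym (size-bump α R)) (+-monoʳ-< (size R) (step-size d)))
step-size (close-l {P} {P′} {Q} {Q′} d e) =
  s≤s (subst (_≤ size P + size Q) (cong suc (+-suc (size P′) (size Q′))) (+-mono-≤ (step-size d) (step-size e)))
step-size (close-r {P} {P′} {Q} {Q′} d e) =
  s≤s (subst (_≤ size Q + size P) (cong suc (+-suc (size Q′) (size P′))) (+-mono-≤ (step-size e) (step-size d)))
step-size (comm-l {Q' = Q′} {y = y} d e) =
  s≤s (subst (λ q → _ + q < _) (sym (size-ren (sub0 y) Q′)) (+-mono-< (step-size d) (step-size e)))
step-size (comm-r {Q' = Q′} {y = y} d e) =
  s≤s (subst (λ q → q + _ < _) (sym (size-ren (sub0 y) Q′)) (+-mono-< (step-size e) (step-size d)))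

-- Scope

extN : Act → ℕ → ℕ
extN τa         n = n
extN (outa _ _) n = n
extN (bouta _)  n = suc n
extN (inpa _)   n = suc n

data ScopedAct (n : ℕ) : Act → Set where
  τa    : ScopedAct n τa
  outa  : ∀ {x z} → x < n → z < n → ScopedAct n (outa x z)
  bouta : ∀ {x} → x < n → ScopedAct n (bouta x)
  inpa  : ∀ {x} → x < n → ScopedAct n (inpa x)

data Scoped (n : ℕ) : Proc → Set where
  𝟘     : Scoped n 𝟘
  ν     : ∀ {P} → Scoped (suc n) P → Scoped n (ν P)
  _∙_   : ∀ {α P} → ScopedAct n α → Scoped (extN α n) P → Scoped n (α ∙ P)
  match : ∀ {x y P} → x < n → y < n → Scoped n P → Scoped n (match x y P)
  _∥_   : ∀ {P Q} → Scoped n P → Scoped n Q → Scoped n (P ∥ Q)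
  _⊕_   : ∀ {P Q} → Scoped n P → Scoped n Q → Scoped n (P ⊕ Q)

data ScopedForm (n : ℕ) : Form → Set where
  tt    : ScopedForm n tt
  ff    : ScopedForm n ff
  _∧_   : ∀ {φ ψ} → ScopedForm n φ → ScopedForm n ψ → ScopedForm n (φ ∧ ψ)
  _∨_   : ∀ {φ ψ} → ScopedForm n φ → ScopedForm n ψ → ScopedForm n (φ ∨ ψ)
  _⊃_   : ∀ {φ ψ} → ScopedForm n φ → ScopedForm n ψ → ScopedForm n (φ ⊃ ψ)
  _≐_   : ∀ {x y} → x < n → y < n → ScopedForm n (x ≐ y)
  ⟨_⟩_  : ∀ {α φ} → ScopedAct n α → ScopedForm (extN α n) φ → ScopedForm n (⟨ α ⟩ φ)
  [_]_  : ∀ {α φ} → ScopedAct n α → ScopedForm (extN α n) φ → ScopedForm n ([ α ] φ)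

AgreeBelow : ℕ → Ren → Ren → Set
AgreeBelow n ρ ρ′ = ∀ {x} → x < n → ρ x ≡ ρ′ x

MapsBelow : ℕ → ℕ → Ren → Set
MapsBelow n m ρ = ∀ {x} → x < n → ρ x < m

agree-ext : ∀ {n ρ ρ′} → AgreeBelow n ρ ρ′ → AgreeBelow (suc n) (ext ρ) (ext ρ′)
agree-ext h {zero}  _       = refl
agree-ext h {suc x} (s≤s p) = cong suc (h p)

agree-extA : ∀ {n ρ ρ′} α → AgreeBelow n ρ ρ′ → AgreeBelow (extN α n) (extA α ρ) (extA α ρ′)
agree-extA τa         h = h
agree-extA (outa _ _) h = h
agree-extA (bouta _)  h = agree-ext h
agree-extA (inpa _)   h = agree-ext h

renA-agree : ∀ {n ρ ρ′ α} → AgreeBelow n ρ ρ′ → ScopedAct n α → renA ρ α ≡ renA ρ′ α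
renA-agree h τa         = refl
renA-agree h (outa p q) = cong₂ outa (h p) (h q)
renA-agree h (bouta p)  = cong bouta (h p)
renA-agree h (inpa p)   = cong inpa (h p)

ren-agree : ∀ {n ρ ρ′ P} → AgreeBelow n ρ ρ′ → Scoped n P → ren ρ P ≡ ren ρ′ P
ren-agree h 𝟘               = refl
ren-agree h (ν s)           = cong ν (ren-agree (agree-ext h) s)
ren-agree h (_∙_ {α} a s)   = cong₂ _∙_ (renA-agree h a) (ren-agree (agree-extA α h) s)
ren-agree h (match p q s)   = match-cong (h p) (h q) (ren-agree h s)
ren-agree h (s ∥ t)         = cong₂ _∥_ (ren-agree h s) (ren-agree h t)
ren-agree h (s ⊕ t)         = cong₂ _⊕_ (ren-agree h s) (ren-agree h t)

renF-agree : ∀ {n ρ ρ′ φ} → AgreeBelow n ρ ρ′ → ScopedForm n φ → renF ρ φ ≡ renF ρ′ φ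
renF-agree h tt              = refl
renF-agree h ff              = refl
renF-agree h (s ∧ t)         = cong₂ _∧_ (renF-agree h s) (renF-agree h t)
renF-agree h (s ∨ t)         = cong₂ _∨_ (renF-agree h s) (renF-agree h t)
renF-agree h (s ⊃ t)         = cong₂ _⊃_ (renF-agree h s) (renF-agree h t)
renF-agree h (p ≐ q)         = cong₂ _≐_ (h p) (h q)
renF-agree h (⟨_⟩_ {α} a s)  = cong₂ ⟨_⟩_ (renA-agree h a) (renF-agree (agree-extA α h) s)
renF-agree h ([_]_ {α} a s)  = cong₂ [_]_ (renA-agree h a) (renF-agree (agree-extA α h) s)

maps-ext : ∀ {n m ρ} → MapsBelow n m ρ → MapsBelow (suc n) (suc m) (ext ρ)
maps-ext h {zero}  _       = s≤s z≤n
maps-ext h {suc x} (s≤s p) = s≤s (h p)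

maps-extA : ∀ {n m ρ} α → MapsBelow n m ρ → MapsBelow (extN α n) (extN (renA ρ α) m) (extA α ρ)
maps-extA τa         h = h
maps-extA (outa _ _) h = h
maps-extA (bouta _)  h = maps-ext h
maps-extA (inpa _)   h = maps-ext h

ScopedAct-ren : ∀ {n m ρ α} → MapsBelow n m ρ → ScopedAct n α → ScopedAct m (renA ρ α)
ScopedAct-ren h τa         = τa
ScopedAct-ren h (outa p q) = outa (h p) (h q)
ScopedAct-ren h (bouta p)  = bouta (h p)
ScopedAct-ren h (inpa p)   = inpa (h p)

ScopedForm-renF : ∀ {n m ρ φ} → MapsBelow n m ρ → ScopedForm n φ → ScopedForm m (renF ρ φ)
ScopedForm-renF h tt             = tt
ScopedForm-renF h ff             = ff
ScopedForm-renF h (s ∧ t)        = ScopedForm-renF h s ∧ ScopedForm-renF h t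
ScopedForm-renF h (s ∨ t)        = ScopedForm-renF h s ∨ ScopedForm-renF h t
ScopedForm-renF h (s ⊃ t)        = ScopedForm-renF h s ⊃ ScopedForm-renF h t
ScopedForm-renF h (p ≐ q)        = h p ≐ h q
ScopedForm-renF h (⟨_⟩_ {α} a s) = ⟨ ScopedAct-ren h a ⟩ ScopedForm-renF (maps-extA α h) s
ScopedForm-renF h ([_]_ {α} a s) = [ ScopedAct-ren h a ] ScopedForm-renF (maps-extA α h) s

UpwardClosed : (ℕ → Set) → Set
UpwardClosed S = ∀ {n m} → n ≤ m → S n → S m

bound₂ : ∀ {S T U : ℕ → Set} → UpwardClosed S → UpwardClosed T →
         (∀ {n} → S n → T n → U n) → ∃ S → ∃ T → ∃ U
bound₂ monoS monoT f (n , s) (m , t) = n ⊔ m , f (monoS (m≤m⊔n n m) s) (monoT (m≤n⊔m n m) t)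

extN-mono : ∀ α {n m} → n ≤ m → extN α n ≤ extN α m
extN-mono τa         le = le
extN-mono (outa _ _) le = le
extN-mono (bouta _)  le = s≤s le
extN-mono (inpa _)   le = s≤s le

n≤extN : ∀ α n → n ≤ extN α n
n≤extN τa         n = ≤-refl
n≤extN (outa _ _) n = ≤-refl
n≤extN (bouta _)  n = n≤1+n n
n≤extN (inpa _)   n = n≤1+n n

ScopedAct-mono : ∀ {α} → UpwardClosed (λ n → ScopedAct n α)
ScopedAct-mono le τa         = τa
ScopedAct-mono le (outa p q) = outa (<-≤-trans p le) (<-≤-trans q le)
ScopedAct-mono le (bouta p)  = bouta (<-≤-trans p le)
ScopedAct-mono le (inpa p)   = inpa (<-≤-trans p le)

Scoped-mono : ∀ {P} → UpwardClosed (λ n → Scoped n P)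
Scoped-mono le 𝟘             = 𝟘
Scoped-mono le (ν s)         = ν (Scoped-mono (s≤s le) s)
Scoped-mono le (_∙_ {α} a s) = ScopedAct-mono le a ∙ Scoped-mono (extN-mono α le) s
Scoped-mono le (match p q s) = match (<-≤-trans p le) (<-≤-trans q le) (Scoped-mono le s)
Scoped-mono le (s ∥ t)       = Scoped-mono le s ∥ Scoped-mono le t
Scoped-mono le (s ⊕ t)       = Scoped-mono le s ⊕ Scoped-mono le t

ScopedForm-mono : ∀ {φ} → UpwardClosed (λ n → ScopedForm n φ)
ScopedForm-mono le tt             = tt
ScopedForm-mono le ff             = ff
ScopedForm-mono le (s ∧ t)        = ScopedForm-mono le s ∧ ScopedForm-mono le t
ScopedForm-mono le (s ∨ t)        = ScopedForm-mono le s ∨ ScopedForm-mono le t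
ScopedForm-mono le (s ⊃ t)        = ScopedForm-mono le s ⊃ ScopedForm-mono le t
ScopedForm-mono le (p ≐ q)        = <-≤-trans p le ≐ <-≤-trans q le
ScopedForm-mono le (⟨_⟩_ {α} a s) = ⟨ ScopedAct-mono le a ⟩ ScopedForm-mono (extN-mono α le) s
ScopedForm-mono le ([_]_ {α} a s) = [ ScopedAct-mono le a ] ScopedForm-mono (extN-mono α le) s

names-bound : ∀ x y → ∃ λ n → x < n × y < n
names-bound x y = suc (x ⊔ y) , s≤s (m≤m⊔n x y) , s≤s (m≤n⊔m x y)

scopedAct-bound : ∀ α → ∃ λ n → ScopedAct n α
scopedAct-bound τa         = 0 , τa
scopedAct-bound (outa x z) with names-bound x z
... | n , p , q = n , outa p q
scopedAct-bound (bouta x)  = suc x , bouta ≤-refl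
scopedAct-bound (inpa x)   = suc x , inpa ≤-refl

under : ∀ {S : ℕ → Set} α → UpwardClosed S → ∃ S → ∃ λ n → S (extN α n)
under α mono (n , s) = n , mono (n≤extN α n) s

scoped-bound : ∀ P → ∃ λ n → Scoped n P
scoped-bound 𝟘             = 0 , 𝟘
scoped-bound (ν P)         with scoped-bound P
... | n , s = n , ν (Scoped-mono (n≤1+n n) s)
scoped-bound (α ∙ P)       = bound₂ ScopedAct-mono (Scoped-mono ∘ extN-mono α) _∙_
                               (scopedAct-bound α) (under α Scoped-mono (scoped-bound P))
scoped-bound (match x y P) = bound₂ {S = λ n → x < n × y < n}
                               (λ le (p , q) → <-≤-trans p le , <-≤-trans q le) Scoped-mono
                               (λ (p , q) → match p q) (names-bound x y) (scoped-bound P)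
scoped-bound (P ∥ Q)       = bound₂ Scoped-mono Scoped-mono _∥_ (scoped-bound P) (scoped-bound Q)
scoped-bound (P ⊕ Q)       = bound₂ Scoped-mono Scoped-mono _⊕_ (scoped-bound P) (scoped-bound Q)

scopedForm-bound : ∀ φ → ∃ λ n → ScopedForm n φ
scopedForm-bound tt        = 0 , tt
scopedForm-bound ff        = 0 , ff
scopedForm-bound (φ ∧ ψ)   = bound₂ ScopedForm-mono ScopedForm-mono _∧_ (scopedForm-bound φ) (scopedForm-bound ψ)
scopedForm-bound (φ ∨ ψ)   = bound₂ ScopedForm-mono ScopedForm-mono _∨_ (scopedForm-bound φ) (scopedForm-bound ψ)
scopedForm-bound (φ ⊃ ψ)   = bound₂ ScopedForm-mono ScopedForm-mono _⊃_ (scopedForm-bound φ) (scopedForm-bound ψ)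
scopedForm-bound (x ≐ y)   with names-bound x y
... | n , p , q = n , (p ≐ q)
scopedForm-bound (⟨ α ⟩ φ) = bound₂ ScopedAct-mono (ScopedForm-mono ∘ extN-mono α) ⟨_⟩_
                               (scopedAct-bound α) (under α ScopedForm-mono (scopedForm-bound φ))
scopedForm-bound ([ α ] φ) = bound₂ ScopedAct-mono (ScopedForm-mono ∘ extN-mono α) [_]_
                               (scopedAct-bound α) (under α ScopedForm-mono (scopedForm-bound φ))

-- Satisfaction under renaming

≡⇒⇔ : ∀ {A B : Set} → A ≡ B → A ⇔ B
≡⇒⇔ refl = ⇔-id _

∃-⇔ : ∀ {A : Set} {B C : A → Set} → (∀ x → B x ⇔ C x) → (∃ B) ⇔ (∃ C)
∃-⇔ f = mk⇔ (λ (x , b) → x , to (f x) b) (λ (x , c) → x , from (f x) c)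

Π-⇔ : ∀ {A : Set} {B C : A → Set} → (∀ x → B x ⇔ C x) → (∀ x → B x) ⇔ (∀ x → C x)
Π-⇔ f = mk⇔ (λ b x → to (f x) (b x)) (λ c x → from (f x) (c x))

relabel : ∀ {P Q α β} → α ≡ β → P —[ α ]→ Q → P —[ β ]→ Q
relabel refl d = d

step-⇔ : ∀ {P Q α β} → α ≡ β → (P —[ α ]→ Q) ⇔ (P —[ β ]→ Q)
step-⇔ e = ≡⇒⇔ (cong (_ —[_]→ _) e)

∷ρ-∘ : ∀ {ρ σ τ} y → ρ ∘ σ ≗ τ → (y ∷ρ ρ) ∘ ext σ ≗ (y ∷ρ τ)
∷ρ-∘ y e zero    = refl
∷ρ-∘ y e (suc n) = e n

sat-renF : ∀ {ρ σ τ} → ρ ∘ σ ≗ τ → ∀ P φ → sat P ρ (renF σ φ) ⇔ sat P τ φ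
sat-renF e P tt               = ⇔-id _
sat-renF e P ff               = ⇔-id _
sat-renF e P (φ ∧ ψ)          = sat-renF e P φ ×-⇔ sat-renF e P ψ
sat-renF e P (φ ∨ ψ)          = sat-renF e P φ ⊎-⇔ sat-renF e P ψ
sat-renF e P (φ ⊃ ψ)          = →-cong-⇔ (sat-renF e P φ) (sat-renF e P ψ)
sat-renF e P (x ≐ y)          = ≡⇒⇔ (cong₂ _≡_ (e x) (e y))
sat-renF e P (⟨ τa ⟩ φ)       = ∃-⇔ λ Q → ⇔-id _ ×-⇔ sat-renF e Q φ
sat-renF e P (⟨ outa a b ⟩ φ) = ∃-⇔ λ Q → step-⇔ (cong₂ outa (e a) (e b)) ×-⇔ sat-renF e Q φ
sat-renF e P (⟨ bouta a ⟩ φ)  = ∃-⇔ λ Q → step-⇔ (cong bouta (e a)) ×-⇔ sat-renF (ext-∘ e) Q φ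
sat-renF e P (⟨ inpa a ⟩ φ)   =
  ∃-⇔ λ Q → step-⇔ (cong inpa (e a)) ×-⇔ Π-⇔ λ y → sat-renF (∷ρ-∘ y e) (ren (sub0 y) Q) φ
sat-renF e P ([ τa ] φ)       = Π-⇔ λ Q → →-cong-⇔ (⇔-id _) (sat-renF e Q φ)
sat-renF e P ([ outa a b ] φ) = Π-⇔ λ Q → →-cong-⇔ (step-⇔ (cong₂ outa (e a) (e b))) (sat-renF e Q φ)
sat-renF e P ([ bouta a ] φ)  = Π-⇔ λ Q → →-cong-⇔ (step-⇔ (cong bouta (e a))) (sat-renF (ext-∘ e) Q φ)
sat-renF e P ([ inpa a ] φ)   =
  Π-⇔ λ Q → →-cong-⇔ (step-⇔ (cong inpa (e a))) (Π-⇔ λ y → sat-renF (∷ρ-∘ y e) (ren (sub0 y) Q) φ)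

sat-agree : ∀ {n ρ ρ′ φ} P → AgreeBelow n ρ ρ′ → ScopedForm n φ → sat P ρ φ ⇔ sat P ρ′ φ
sat-agree {φ = φ} P h s =
  ⇔-trans (⇔-sym (sat-renF (λ _ → refl) P φ))
          (⇔-trans (≡⇒⇔ (cong (sat P id) (renF-agree h s))) (sat-renF (λ _ → refl) P φ))

sat-≗ : ∀ {ρ ρ′} P φ → ρ ≗ ρ′ → sat P ρ φ ⇔ sat P ρ′ φ
sat-≗ P φ e = sat-agree P (λ {x} _ → e x) (proj₂ (scopedForm-bound φ))

-- Transfer of satisfaction

Cont : Act → Ren → Proc → Form → Set
Cont (bouta _) ρ Z φ = sat Z (ext ρ) φ
Cont (inpa _)  ρ Z φ = ∀ y → sat (ren (sub0 y) Z) (y ∷ρ ρ) φ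
Cont _         ρ Z φ = sat Z ρ φ

sat-⟨⟩ : ∀ α {X ρ φ} → sat X ρ (⟨ α ⟩ φ) ≡ (∃ λ X′ → X —[ renA ρ α ]→ X′ × Cont α ρ X′ φ)
sat-⟨⟩ τa         = refl
sat-⟨⟩ (outa _ _) = refl
sat-⟨⟩ (bouta _)  = refl
sat-⟨⟩ (inpa _)   = refl

sat-[] : ∀ α {X ρ φ} → sat X ρ ([ α ] φ) ≡ (∀ X′ → X —[ renA ρ α ]→ X′ → Cont α ρ X′ φ)
sat-[] τa         = refl
sat-[] (outa _ _) = refl
sat-[] (bouta _)  = refl
sat-[] (inpa _)   = refl

⊨̇-⟨⟩ : ∀ α {X φ} → (X ⊨̇ ⟨ α ⟩ φ) ≡ (∃ λ X′ → X —[ α ]→ X′ × Cont α id X′ φ)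
⊨̇-⟨⟩ τa         = refl
⊨̇-⟨⟩ (outa _ _) = refl
⊨̇-⟨⟩ (bouta _)  = refl
⊨̇-⟨⟩ (inpa _)   = refl

EnvRel : Set₁
EnvRel = Proc → Ren → Proc → Ren → Set

Next : Act → EnvRel → EnvRel
Next (bouta _) S X ρ Y τ = S X (ext ρ) Y (ext τ)
Next (inpa _)  S X ρ Y τ =
  (∀ y′ → ∃ λ y → S (ren (sub0 y) X) (y ∷ρ ρ) (ren (sub0 y′) Y) (y′ ∷ρ τ)) ×
  (∀ y → ∃ λ y′ → S (ren (sub0 y) X) (y ∷ρ ρ) (ren (sub0 y′) Y) (y′ ∷ρ τ))
Next _         S X ρ Y τ = S X ρ Y τ

record SatTransfer (S : EnvRel) : Set where
  field
    flip   : ∀ {X ρ Y τ} → S X ρ Y τ → S Y τ X ρ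
    ≐-pres : ∀ {X ρ Y τ x y} → S X ρ Y τ → ρ x ≡ ρ y → τ x ≡ τ y
    step   : ∀ {X ρ Y τ X′} α → S X ρ Y τ → X —[ renA ρ α ]→ X′ →
             ∃ λ Y′ → Y —[ renA τ α ]→ Y′ × Next α S X′ ρ Y′ τ

  next-flip : ∀ α {X ρ Y τ} → Next α S X ρ Y τ → Next α S Y τ X ρ
  next-flip τa         r         = flip r
  next-flip (outa _ _) r         = flip r
  next-flip (bouta _)  r         = flip r
  next-flip (inpa _)   (bk , fw) =
    (λ y → let y′ , r = fw y in y′ , flip r) , (λ y′ → let y , r = bk y′ in y , flip r)

  sat-transfer : ∀ {X ρ Y τ} φ → S X ρ Y τ → sat X ρ φ → sat Y τ φ
  cont-transfer : ∀ α {X ρ Y τ} φ → Next α S X ρ Y τ → Cont α ρ X φ → Cont α τ Y φ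

  sat-transfer tt        r s         = s
  sat-transfer ff        r ()
  sat-transfer (φ ∧ ψ)   r (s , t)   = sat-transfer φ r s , sat-transfer ψ r t
  sat-transfer (φ ∨ ψ)   r (inj₁ s)  = inj₁ (sat-transfer φ r s)
  sat-transfer (φ ∨ ψ)   r (inj₂ t)  = inj₂ (sat-transfer ψ r t)
  sat-transfer (φ ⊃ ψ)   r h         = sat-transfer ψ r ∘ h ∘ sat-transfer φ (flip r)
  sat-transfer (x ≐ y)   r s         = ≐-pres r s
  sat-transfer (⟨ α ⟩ φ) r s with subst id (sat-⟨⟩ α) s
  ... | X′ , d , c with step α r d
  ...   | Y′ , d′ , n = subst id (sym (sat-⟨⟩ α)) (Y′ , d′ , cont-transfer α φ n c)
  sat-transfer ([ α ] φ) r h = subst id (sym (sat-[] α)) back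
    where
    back : ∀ Y′ → _ —[ renA _ α ]→ Y′ → Cont α _ Y′ φ
    back Y′ d′ with step α (flip r) d′
    ... | X′ , d , n = cont-transfer α φ (next-flip α n) (subst id (sat-[] α) h X′ d)

  cont-transfer τa         φ r         c    = sat-transfer φ r c
  cont-transfer (outa _ _) φ r         c    = sat-transfer φ r c
  cont-transfer (bouta _)  φ r         c    = sat-transfer φ r c
  cont-transfer (inpa _)   φ (bk , _)  c y′ = let y , r = bk y′ in sat-transfer φ r (c y)

open SatTransfer using (sat-transfer)

late-transfer : ∀ {R} → LateBisim R → SatTransfer (λ X ρ Y τ → R X Y × ρ ≡ τ)
late-transfer {R} B = record
  { flip   = λ (r , e) → symm r , sym e
  ; ≐-pres = λ { (_ , refl) e → e }
  ; step   = step
  }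
  where
  open LateBisim B
  step : ∀ {X ρ Y τ X′} α → R X Y × ρ ≡ τ → X —[ renA ρ α ]→ X′ →
         ∃ λ Y′ → Y —[ renA τ α ]→ Y′ × Next α (λ X ρ Y τ → R X Y × ρ ≡ τ) X′ ρ Y′ τ
  step τa         (r , refl) d = let Y′ , d′ , r′ = sim-τ r d    in Y′ , d′ , r′ , refl
  step (outa _ _) (r , refl) d = let Y′ , d′ , r′ = sim-out r d  in Y′ , d′ , r′ , refl
  step (bouta _)  (r , refl) d = let Y′ , d′ , r′ = sim-bout r d in Y′ , d′ , r′ , refl
  step (inpa _)   (r , refl) d =
    let Y′ , d′ , r′ = sim-inp r d in Y′ , d′ , (λ y → y , r′ y , refl) , (λ y → y , r′ y , refl)

late-bisim-sat : ∀ {R X Y} → LateBisim R → R X Y → ∀ ρ φ → sat X ρ φ → sat Y ρ φ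
late-bisim-sat B r ρ φ = sat-transfer (late-transfer B) φ (r , refl)

⟦_⟧ : ℕ ↔ ℕ → Ren
⟦ π ⟧ = Inverse.to π

⟦_⟧⁻¹ : ℕ ↔ ℕ → Ren
⟦ π ⟧⁻¹ = Inverse.from π

↔-ext : ℕ ↔ ℕ → ℕ ↔ ℕ
↔-ext π = mk↔ₛ′ (ext ⟦ π ⟧) (ext ⟦ π ⟧⁻¹) (ext-inverse (strictlyInverseˡ π)) (ext-inverse (strictlyInverseʳ π))
  where
  ext-inverse : ∀ {ρ σ} → ρ ∘ σ ≗ id → ext ρ ∘ ext σ ≗ id
  ext-inverse e n = trans (ext-∘ e n) (ext-≗id (λ _ → refl) n)

ren-inverse : ∀ π X → ren ⟦ π ⟧⁻¹ (ren ⟦ π ⟧ X) ≡ X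
ren-inverse π X = trans (ren-∘ (strictlyInverseʳ π) X) (ren-≗id (λ _ → refl) X)

Renamed : EnvRel
Renamed X ρ Y τ = ∃ λ π → Y ≡ ren ⟦ π ⟧ X × ⟦ π ⟧ ∘ ρ ≗ τ

renamed-transfer : SatTransfer Renamed
renamed-transfer = record { flip = flip ; ≐-pres = ≐-pres ; step = step }
  where
  flip : ∀ {X ρ Y τ} → Renamed X ρ Y τ → Renamed Y τ X ρ
  flip {X} {ρ} (π , refl , e) =
    ↔-sym π , sym (ren-inverse π X) , λ n → trans (cong ⟦ π ⟧⁻¹ (sym (e n))) (strictlyInverseʳ π (ρ n))

  ≐-pres : ∀ {X ρ Y τ x y} → Renamed X ρ Y τ → ρ x ≡ ρ y → τ x ≡ τ y
  ≐-pres {x = x} {y} (π , _ , e) eq = trans (sym (e x)) (trans (cong ⟦ π ⟧ eq) (e y))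

  instance-renamed : ∀ {X′ ρ τ} π → ⟦ π ⟧ ∘ ρ ≗ τ → ∀ y y′ → ⟦ π ⟧ y ≡ y′ →
                     Renamed (ren (sub0 y) X′) (y ∷ρ ρ) (ren (sub0 y′) (ren (ext ⟦ π ⟧) X′)) (y′ ∷ρ τ)
  instance-renamed {X′} π e y _ refl = π , ren-square (sub0-natural ⟦ π ⟧ y) X′ , λ { zero → refl ; (suc n) → e n }

  step : ∀ {X ρ Y τ X′} α → Renamed X ρ Y τ → X —[ renA ρ α ]→ X′ →
         ∃ λ Y′ → Y —[ renA τ α ]→ Y′ × Next α Renamed X′ ρ Y′ τ
  step τa         (π , refl , e) d = _ , step-ren ⟦ π ⟧ d , π , refl , e
  step (outa a b) (π , refl , e) d = _ , relabel (cong₂ outa (e a) (e b)) (step-ren ⟦ π ⟧ d) , π , refl , e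
  step (bouta a)  (π , refl , e) d = _ , relabel (cong bouta (e a)) (step-ren ⟦ π ⟧ d) , ↔-ext π , refl , ext-∘ e
  step (inpa a)   (π , refl , e) d =
    _ , relabel (cong inpa (e a)) (step-ren ⟦ π ⟧ d) ,
    (λ y′ → ⟦ π ⟧⁻¹ y′ , instance-renamed π e _ y′ (strictlyInverseˡ π y′)) ,
    (λ y → ⟦ π ⟧ y , instance-renamed π e y _ refl)

sat-ren-↔ : ∀ {X ρ τ} π φ → ⟦ π ⟧ ∘ ρ ≗ τ → sat X ρ φ → sat (ren ⟦ π ⟧ X) τ φ
sat-ren-↔ π φ e = sat-transfer renamed-transfer φ (π , refl , e)

⟦⟧-injective : ∀ π {a b} → ⟦ π ⟧ a ≡ ⟦ π ⟧ b → a ≡ b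
⟦⟧-injective π {a} {b} e = trans (sym (strictlyInverseʳ π a)) (trans (cong ⟦ π ⟧⁻¹ e) (strictlyInverseʳ π b))

transpose : ℕ → ℕ → Ren
transpose a b x with x ≟ a
... | yes _ = b
... | no _ with x ≟ b
...   | yes _ = a
...   | no _  = x

transpose-left : ∀ a b → transpose a b a ≡ b
transpose-left a b with a ≟ a
... | yes _ = refl
... | no ¬p = ⊥-elim (¬p refl)

transpose-right : ∀ a b → transpose a b b ≡ a
transpose-right a b with b ≟ a
... | yes p = p
... | no _ with b ≟ b
...   | yes _ = refl
...   | no ¬p = ⊥-elim (¬p refl)

transpose-other : ∀ {a b x} → x ≢ a → x ≢ b → transpose a b x ≡ x
transpose-other {a} {b} {x} x≢a x≢b with x ≟ a
... | yes p = ⊥-elim (x≢a p)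
... | no _ with x ≟ b
...   | yes p = ⊥-elim (x≢b p)
...   | no _  = refl

transpose-involutive : ∀ a b x → transpose a b (transpose a b x) ≡ x
transpose-involutive a b x with x ≟ a
... | yes refl = transpose-right x b
... | no x≢a with x ≟ b
...   | yes refl = transpose-left a x
...   | no x≢b   = transpose-other x≢a x≢b

transposition : ℕ → ℕ → ℕ ↔ ℕ
transposition a b =
  mk↔ₛ′ (transpose a b) (transpose a b) (transpose-involutive a b) (transpose-involutive a b)

-- Logical equivalence

LogEq : Proc → Proc → Set
LogEq X Y = ∀ ρ φ → sat X ρ φ ⇔ sat Y ρ φ

logEq-sym : ∀ {X Y} → LogEq X Y → LogEq Y X
logEq-sym e ρ φ = ⇔-sym (e ρ φ)

logEq-ren : ∀ {X Y} π → LogEq X Y → LogEq (ren ⟦ π ⟧ X) (ren ⟦ π ⟧ Y)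
logEq-ren π e ρ φ = mk⇔ (transport e) (transport (logEq-sym e))
  where
  transport : ∀ {A B} → LogEq A B → sat (ren ⟦ π ⟧ A) ρ φ → sat (ren ⟦ π ⟧ B) ρ φ
  transport {A} e′ =
    sat-ren-↔ π φ (strictlyInverseˡ π ∘ ρ) ∘ to (e′ (⟦ π ⟧⁻¹ ∘ ρ) φ) ∘
    subst (λ Z → sat Z (⟦ π ⟧⁻¹ ∘ ρ) φ) (ren-inverse π A) ∘ sat-ren-↔ (↔-sym π) φ (λ _ → refl)

Separated : (Proc → Form → Set) → Proc → Proc → Set
Separated H X Y = ∃ λ φ → H X φ × ¬ H Y φ

Dist : Proc → Proc → Set
Dist = Separated _⊨̇_

dist-sym : ∀ {X Y} → Dist X Y → Dist Y X
dist-sym (φ , s , ¬s) = (φ ⊃ ff) , ¬s , λ h → h s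

logEq⇒¬dist : ∀ {X Y} → LogEq X Y → ¬ Dist X Y
logEq⇒¬dist e (φ , s , ¬s) = ¬s (to (e id φ) s)

Instances : (Proc → Proc → Set) → Proc → Proc → Set
Instances R X′ Y′ = ∀ y → R (ren (sub0 y) X′) (ren (sub0 y) Y′)

Matched : Act → Proc → Proc → Set
Matched (inpa _) X′ Y′ = Instances LogEq X′ Y′
Matched _        X′ Y′ = LogEq X′ Y′

matched-sym : ∀ α {X′ Y′} → Matched α X′ Y′ → Matched α Y′ X′
matched-sym τa         m   = logEq-sym m
matched-sym (outa _ _) m   = logEq-sym m
matched-sym (bouta _)  m   = logEq-sym m
matched-sym (inpa _)   m y = logEq-sym (m y)

cont-matched : ∀ α {ρ X′ Y′ φ} → Matched (renA ρ α) X′ Y′ → Cont α ρ X′ φ → Cont α ρ Y′ φ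
cont-matched τa         m     = to (m _ _)
cont-matched (outa _ _) m     = to (m _ _)
cont-matched (bouta _)  m     = to (m _ _)
cont-matched (inpa _)   m c y = to (m y _ _) (c y)

Forth : Proc → Proc → Set
Forth X Y = ∀ {α X′} → X —[ α ]→ X′ → ∃ λ Y′ → Y —[ α ]→ Y′ × Matched α X′ Y′

forth-sat : ∀ {X Y} → Forth X Y → Forth Y X → ∀ ρ φ → sat X ρ φ → sat Y ρ φ
forth-sat f b ρ tt        s        = s
forth-sat f b ρ ff        ()
forth-sat f b ρ (φ ∧ ψ)   (s , t)  = forth-sat f b ρ φ s , forth-sat f b ρ ψ t
forth-sat f b ρ (φ ∨ ψ)   (inj₁ s) = inj₁ (forth-sat f b ρ φ s)
forth-sat f b ρ (φ ∨ ψ)   (inj₂ t) = inj₂ (forth-sat f b ρ ψ t)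
forth-sat f b ρ (φ ⊃ ψ)   h        = forth-sat f b ρ ψ ∘ h ∘ forth-sat b f ρ φ
forth-sat f b ρ (x ≐ y)   s        = s
forth-sat f b ρ (⟨ α ⟩ φ) s with subst id (sat-⟨⟩ α) s
... | X′ , d , c with f d
...   | Y′ , d′ , m = subst id (sym (sat-⟨⟩ α)) (Y′ , d′ , cont-matched α m c)
forth-sat {Y = Y} f b ρ ([ α ] φ) h = subst id (sym (sat-[] α)) after
  where
  after : ∀ Y′ → Y —[ renA ρ α ]→ Y′ → Cont α ρ Y′ φ
  after Y′ d′ with b d′
  ... | X′ , d , m = cont-matched α (matched-sym (renA ρ α) m) (subst id (sat-[] α) h X′ d)

forth-back⇒logEq : ∀ {X Y} → Forth X Y → Forth Y X → LogEq X Y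
forth-back⇒logEq f b ρ φ = mk⇔ (forth-sat f b ρ φ) (forth-sat b f ρ φ)

-- Finite branching

Step : Proc → Set
Step P = Σ Act λ α → ∃ λ Q → P —[ α ]→ Q

lift : ∀ {P P′} → (∀ {α Q} → P —[ α ]→ Q → P′ —[ α ]→ Q) → Step P → Step P′
lift f (α , Q , d) = α , Q , f d

restrict : ∀ {P} → Step P → List (Step (ν P))
restrict (τa , Q , d)                    = (τa , ν Q , res-τ d) ∷ []
restrict (outa zero _ , _)               = []
restrict (outa (suc a) zero , Q , d)     = (bouta a , Q , open' d) ∷ []
restrict (outa (suc a) (suc b) , Q , d)  = (outa a b , ν Q , res-out d) ∷ []
restrict (bouta zero , _)                = []
restrict (bouta (suc a) , Q , d)         = (bouta a , ν (ren swap Q) , res-bout d) ∷ []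
restrict (inpa zero , _)                 = []
restrict (inpa (suc a) , Q , d)          = (inpa a , ν (ren swap Q) , res-inp d) ∷ []

par-left : ∀ {P} R → Step P → Step (P ∥ R)
par-left R (α , Q , d) = α , (Q ∥ bump α R) , par-l d

par-right : ∀ {P} R → Step P → Step (R ∥ P)
par-right R (α , Q , d) = α , (bump α R ∥ Q) , par-r d

sync : ∀ {A B : Set} {x x′ : A} → Dec (x ≡ x′) → (x ≡ x′ → B) → List B
sync (yes p) f = f p ∷ []
sync (no _)  _ = []

sync-self : ∀ {A B : Set} (_≟_ : DecidableEquality A) x (f : x ≡ x → B) → f refl ∈ sync (x ≟ x) f
sync-self _≟_ x f rewrite ≡-≟-identity _≟_ {x} refl = here refl

communications : ∀ {P R} → Step P → Step R → List (Step (P ∥ R))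
communications (bouta x , P′ , d) (inpa x′ , R′ , e) =
  sync (x ≟ x′) λ { refl → τa , ν (P′ ∥ R′) , close-l d e }
communications (outa x y , P′ , d) (inpa x′ , R′ , e) =
  sync (x ≟ x′) λ { refl → τa , (P′ ∥ ren (sub0 y) R′) , comm-l d e }
communications (inpa x′ , P′ , d) (bouta x , R′ , e) =
  sync (x ≟ x′) λ { refl → τa , ν (P′ ∥ R′) , close-r e d }
communications (inpa x′ , P′ , d) (outa x y , R′ , e) =
  sync (x ≟ x′) λ { refl → τa , (ren (sub0 y) P′ ∥ R′) , comm-r e d }
communications _ _ = []

steps : (P : Proc) → List (Step P)
steps 𝟘             = []
steps (ν P)         = concatMap restrict (steps P)
steps (α ∙ P)       = (α , P , pre) ∷ []
steps (match x y P) with x ≟ y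
... | yes refl = map (lift mat) (steps P)
... | no _     = []
steps (P ∥ R)       = map (par-left R) (steps P) ++ map (par-right P) (steps R) ++
                      concat (cartesianProductWith communications (steps P) (steps R))
steps (P ⊕ R)       = map (lift sum-l) (steps P) ++ map (lift sum-r) (steps R)

∈-concatMap⁺′ : ∀ {A B : Set} {f : A → List B} {x xs y} → y ∈ f x → x ∈ xs → y ∈ concatMap f xs
∈-concatMap⁺′ {f = f} p q = ∈-concat⁺′ p (∈-map⁺ f q)

∈-communications : ∀ {P R} {s₁ : Step P} {s₂ : Step R} {s} → s ∈ communications s₁ s₂ →
                   s₁ ∈ steps P → s₂ ∈ steps R → s ∈ steps (P ∥ R)
∈-communications {P} {R} p q r =
  ∈-++⁺ʳ (map (par-left R) (steps P)) (∈-++⁺ʳ (map (par-right P) (steps R))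
    (∈-concat⁺′ p (∈-cartesianProductWith⁺ communications q r)))

steps-complete : ∀ {P α Q} (d : P —[ α ]→ Q) → (α , Q , d) ∈ steps P
steps-complete pre           = here refl
steps-complete (open' d)     = ∈-concatMap⁺′ (here refl) (steps-complete d)
steps-complete (sum-l d)     = ∈-++⁺ˡ (∈-map⁺ (lift sum-l) (steps-complete d))
steps-complete (sum-r {Q = P} d) = ∈-++⁺ʳ (map (lift sum-l) (steps P)) (∈-map⁺ (lift sum-r) (steps-complete d))
steps-complete (mat {x = x} d) rewrite ≡-≟-identity _≟_ {x} refl = ∈-map⁺ (lift mat) (steps-complete d)
steps-complete (res-τ d)     = ∈-concatMap⁺′ (here refl) (steps-complete d)
steps-complete (res-out d)   = ∈-concatMap⁺′ (here refl) (steps-complete d)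
steps-complete (res-bout d)  = ∈-concatMap⁺′ (here refl) (steps-complete d)
steps-complete (res-inp d)   = ∈-concatMap⁺′ (here refl) (steps-complete d)
steps-complete (par-l {R = R} d) = ∈-++⁺ˡ (∈-map⁺ (par-left R) (steps-complete d))
steps-complete (par-r {P = P} {R = R} d) =
  ∈-++⁺ʳ (map (par-left P) (steps R)) (∈-++⁺ˡ (∈-map⁺ (par-right R) (steps-complete d)))
steps-complete (close-l {x = x} d e) =
  ∈-communications (sync-self _≟_ x _) (steps-complete d) (steps-complete e)
steps-complete (close-r {x = x} d e) =
  ∈-communications (sync-self _≟_ x _) (steps-complete e) (steps-complete d)
steps-complete (comm-l {x = x} d e) =
  ∈-communications (sync-self _≟_ x _) (steps-complete d) (steps-complete e)
steps-complete (comm-r {x = x} d e) =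
  ∈-communications (sync-self _≟_ x _) (steps-complete e) (steps-complete d)

encode : Act → ℕ × ℕ × ℕ
encode τa         = 0 , 0 , 0
encode (outa x z) = 1 , x , z
encode (bouta x)  = 2 , x , 0
encode (inpa x)   = 3 , x , 0

decode : ℕ × ℕ × ℕ → Act
decode (0 , _ , _)           = τa
decode (1 , x , z)           = outa x z
decode (2 , x , _)           = bouta x
decode (_ , x , _)           = inpa x

decode-encode : ∀ α → decode (encode α) ≡ α
decode-encode τa         = refl
decode-encode (outa _ _) = refl
decode-encode (bouta _)  = refl
decode-encode (inpa _)   = refl

_≟A_ : DecidableEquality Act
α ≟A β = map′ encode-injective (cong encode) (≡-dec _≟_ (≡-dec _≟_ _≟_) (encode α) (encode β))
  where
  encode-injective : encode α ≡ encode β → α ≡ β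
  encode-injective e = trans (sym (decode-encode α)) (trans (cong decode e) (decode-encode β))

with-label : ∀ {P} α → Step P → List (∃ λ Q → P —[ α ]→ Q)
with-label α (β , Q , d) = sync (β ≟A α) λ { refl → Q , d }

successors : (P : Proc) (α : Act) → List (∃ λ Q → P —[ α ]→ Q)
successors P α = concatMap (with-label α) (steps P)

successors-complete : ∀ {P α Q} (d : P —[ α ]→ Q) → (Q , d) ∈ successors P α
successors-complete {α = α} d = ∈-concatMap⁺′ (sync-self _≟A_ α _) (steps-complete d)

-- Deciding logical equivalence

all-or-any : ∀ {A : Set} {P Q : A → Set} → (∀ x → P x ⊎ Q x) → ∀ xs → All P xs ⊎ Any Q xs
all-or-any f []       = inj₁ []
all-or-any f (x ∷ xs) with f x | all-or-any f xs
... | inj₂ q | _       = inj₂ (here q)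
... | inj₁ p | inj₁ ps = inj₁ (p ∷ ps)
... | inj₁ _ | inj₂ qs = inj₂ (there qs)

search-below : ∀ {A B : ℕ → Set} m → (∀ y → y < m → A y ⊎ B y) →
               (∀ {y} → y < m → A y) ⊎ ∃ λ y → y < m × B y
search-below zero    f = inj₁ λ ()
search-below (suc m) f with search-below m (λ y p → f y (m<n⇒m<1+n p)) | f m ≤-refl
... | inj₂ (y , p , b) | _     = inj₂ (y , m<n⇒m<1+n p , b)
... | inj₁ _           | inj₂ b = inj₂ (m , ≤-refl , b)
... | inj₁ below       | inj₁ a = inj₁ λ p → [ below , (λ { refl → a }) ]′ (m<1+n⇒m<n∨m≡n p)

instance-transpose : ∀ {N y Z} → N < y → Scoped (suc N) Z →
                     ren (transpose N y) (ren (sub0 N) Z) ≡ ren (sub0 y) Z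
instance-transpose {N} {y} {Z} N<y s = trans (ren-∘ (λ _ → refl) Z) (ren-agree agree s)
  where
  agree : AgreeBelow (suc N) (transpose N y ∘ sub0 N) (sub0 y)
  agree {zero}  _         = transpose-left N y
  agree {suc x} (s≤s x<N) = transpose-other (<⇒≢ x<N) (<⇒≢ (<-trans x<N N<y))

fresh-instances : ∀ {N X′ Y′} → Scoped (suc N) X′ → Scoped (suc N) Y′ →
                  (∀ {y} → y < suc N → LogEq (ren (sub0 y) X′) (ren (sub0 y) Y′)) →
                  Instances LogEq X′ Y′
fresh-instances {N} sX sY below y with y <? suc N
... | yes p = below p
... | no ¬p = subst₂ LogEq (instance-transpose (≮⇒≥ ¬p) sX) (instance-transpose (≮⇒≥ ¬p) sY)
                (logEq-ren (transposition N y) (below ≤-refl))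

Decider : ℕ → Set
Decider n = ∀ X Y → size X + size Y < n → LogEq X Y ⊎ Dist X Y

size-instances : ∀ y X′ Y′ → size (ren (sub0 y) X′) + size (ren (sub0 y) Y′) ≡ size X′ + size Y′
size-instances y X′ Y′ = cong₂ _+_ (size-ren (sub0 y) X′) (size-ren (sub0 y) Y′)

compare-instances : ∀ {n} → Decider n → ∀ X′ Y′ → size X′ + size Y′ < n →
                    Instances LogEq X′ Y′ ⊎ ∃ λ y → Dist (ren (sub0 y) X′) (ren (sub0 y) Y′)
compare-instances {n} dec X′ Y′ lt
  with bound₂ Scoped-mono Scoped-mono _,_ (scoped-bound X′) (scoped-bound Y′)
... | N , sX , sY
  with search-below (suc N)
         (λ y _ → dec (ren (sub0 y) X′) (ren (sub0 y) Y′) (subst (_< n) (sym (size-instances y X′ Y′)) lt))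
...   | inj₂ (y , _ , d) = inj₂ (y , d)
...   | inj₁ below       = inj₁ (fresh-instances (Scoped-mono (n≤1+n N) sX) (Scoped-mono (n≤1+n N) sY) below)

Cont-tt : ∀ α {ρ Z} → Cont α ρ Z tt
Cont-tt τa         = ⋆
Cont-tt (outa _ _) = ⋆
Cont-tt (bouta _)  = ⋆
Cont-tt (inpa _)   = λ _ → ⋆

Cont-∧ : ∀ α {ρ Z φ ψ} → Cont α ρ Z (φ ∧ ψ) ⇔ (Cont α ρ Z φ × Cont α ρ Z ψ)
Cont-∧ τa         = ⇔-id _
Cont-∧ (outa _ _) = ⇔-id _
Cont-∧ (bouta _)  = ⇔-id _
Cont-∧ (inpa _)   = mk⇔ (λ c → proj₁ ∘ c , proj₂ ∘ c) (λ (c , c′) y → c y , c′ y)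

conjoin : ∀ α {X′} Zs → All (Separated (Cont α id) X′) Zs →
          ∃ λ φ → Cont α id X′ φ × All (λ Z → ¬ Cont α id Z φ) Zs
conjoin α []       []                    = tt , Cont-tt α , []
conjoin α (Z ∷ Zs) ((φ , s , ¬s) ∷ seps) with conjoin α Zs seps
... | ψ , t , ¬ts = (φ ∧ ψ) , from (Cont-∧ α) (s , t) ,
                    (¬s ∘ proj₁ ∘ to (Cont-∧ α)) ∷ All.map (_∘ proj₂ ∘ to (Cont-∧ α)) ¬ts

compare-cont : ∀ {n} → Decider n → ∀ α X′ Y′ → size X′ + size Y′ < n →
               Matched α X′ Y′ ⊎ Separated (Cont α id) X′ Y′
compare-cont dec τa         X′ Y′ lt = dec X′ Y′ lt
compare-cont dec (outa _ _) X′ Y′ lt = dec X′ Y′ lt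
compare-cont dec (bouta a)  X′ Y′ lt = Sum.map₂ under-binder (dec X′ Y′ lt)
  where
  id≗ext-id : id ≗ ext id
  id≗ext-id zero    = refl
  id≗ext-id (suc n) = refl
  under-binder : Dist X′ Y′ → Separated (Cont (bouta a) id) X′ Y′
  under-binder (φ , s , ¬s) = φ , to (sat-≗ X′ φ id≗ext-id) s , ¬s ∘ from (sat-≗ Y′ φ id≗ext-id)
compare-cont dec (inpa a)   X′ Y′ lt = Sum.map₂ at-received (compare-instances dec X′ Y′ lt)
  where
  -- "if the received name is y then φ", with φ shifted past the input binder
  at-received : (∃ λ y → Dist (ren (sub0 y) X′) (ren (sub0 y) Y′)) → Separated (Cont (inpa a) id) X′ Y′
  at-received (y , φ , s , ¬s) =
    ((0 ≐ suc y) ⊃ renF suc φ) ,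
    (λ { _ refl → from (sat-renF (λ _ → refl) (ren (sub0 y) X′) φ) s }) ,
    (λ h → ¬s (to (sat-renF (λ _ → refl) (ren (sub0 y) Y′) φ) (h y refl)))

MatchedIn : Proc → ∀ {X} → Step X → Set
MatchedIn Y (α , X′ , _) = ∃ λ Y′ → Y —[ α ]→ Y′ × Matched α X′ Y′

match-step : ∀ {X Y} → Decider (size X + size Y) → (s : Step X) → MatchedIn Y s ⊎ Dist X Y
match-step {Y = Y} dec (α , X′ , d)
  with all-or-any (λ (Y′ , d′) → Sum.swap (compare-cont dec α X′ Y′ (+-mono-< (step-size d) (step-size d′))))
                  (successors Y α)
... | inj₂ matched = let (Y′ , d′) , m = satisfied matched in inj₁ (Y′ , d′ , m)
... | inj₁ seps with conjoin α _ (All-map⁺ seps)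
...   | φ , s , fails = inj₂ (⟨ α ⟩ φ , subst id (sym (⊨̇-⟨⟩ α)) (X′ , d , s) , ¬Y⊨)
  where
  ¬Y⊨ : ¬ (Y ⊨̇ ⟨ α ⟩ φ)
  ¬Y⊨ h = let Y′ , d′ , c = subst id (⊨̇-⟨⟩ α) h in
          All.lookup fails (∈-map⁺ proj₁ (successors-complete d′)) c

forth-or-dist : ∀ {X Y} → Decider (size X + size Y) → Forth X Y ⊎ Dist X Y
forth-or-dist {X} dec with all-or-any (match-step dec) (steps X)
... | inj₁ ms = inj₁ λ d → All.lookup ms (steps-complete d)
... | inj₂ ds = inj₂ (proj₂ (satisfied ds))

logEq-or-dist : ∀ {X Y} → Forth X Y ⊎ Dist X Y → Forth Y X ⊎ Dist Y X → LogEq X Y ⊎ Dist X Y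
logEq-or-dist (inj₂ d) _        = inj₂ d
logEq-or-dist (inj₁ _) (inj₂ d) = inj₂ (dist-sym d)
logEq-or-dist (inj₁ f) (inj₁ b) = inj₁ (forth-back⇒logEq f b)

decide-acc : ∀ X Y → Acc _<_ (size X + size Y) → LogEq X Y ⊎ Dist X Y
decide-acc X Y (acc rs) =
  logEq-or-dist (forth-or-dist dec) (forth-or-dist (subst Decider (+-comm (size X) (size Y)) dec))
  where
  dec : Decider (size X + size Y)
  dec X′ Y′ lt = decide-acc X′ Y′ (rs lt)

decide : ∀ X Y → LogEq X Y ⊎ Dist X Y
decide X Y = decide-acc X Y (<-wellFounded _)

logEq⇒forth : ∀ {X Y} → LogEq X Y → Forth X Y
logEq⇒forth e = [ id , ⊥-elim ∘ logEq⇒¬dist e ]′ (forth-or-dist (λ X′ Y′ _ → decide X′ Y′))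

logEq-bisim : LateBisim LogEq
logEq-bisim = record
  { symm     = logEq-sym
  ; sim-τ    = λ e → logEq⇒forth e
  ; sim-out  = λ e → logEq⇒forth e
  ; sim-bout = λ e → logEq⇒forth e
  ; sim-inp  = λ e → logEq⇒forth e
  }

-- Kernels of substitutions

SameKernel : ℕ → Ren → Ren → Set
SameKernel n g h = ∀ {x y} → x < n → y < n → (g x ≡ g y) ⇔ (h x ≡ h y)

kernel-bijection : ∀ n {g h} → SameKernel n g h → ∃ λ π → AgreeBelow n (⟦ π ⟧ ∘ g) h
kernel-bijection zero    K = ↔-id ℕ , λ ()
kernel-bijection (suc n) {g} {h} K
  with kernel-bijection n (λ p q → K (m<n⇒m<1+n p) (m<n⇒m<1+n q))
     | search-below n (λ x _ → Sum.swap (toSum (g x ≟ g n)))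
... | π , agree | inj₂ (x , x<n , gx≡gn) = π , extend
  where
  extend : AgreeBelow (suc n) (⟦ π ⟧ ∘ g) h
  extend p with m<1+n⇒m<n∨m≡n p
  ... | inj₁ p′   = agree p′
  ... | inj₂ refl = trans (cong ⟦ π ⟧ (sym gx≡gn)) (trans (agree x<n) (to (K (m<n⇒m<1+n x<n) ≤-refl) gx≡gn))
... | π , agree | inj₁ new = transposition (⟦ π ⟧ (g n)) (h n) ↔-∘ π , extend
  where
  extend : AgreeBelow (suc n) (transpose (⟦ π ⟧ (g n)) (h n) ∘ ⟦ π ⟧ ∘ g) h
  extend p with m<1+n⇒m<n∨m≡n p
  ... | inj₂ refl = transpose-left (⟦ π ⟧ (g n)) (h n)
  -- h x is neither h n nor ⟦ π ⟧ (g n), as no x < n has g x ≡ g n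
  ... | inj₁ p′   = trans (cong (transpose _ _) (agree p′))
                          (transpose-other (λ e → new p′ (⟦⟧-injective π (trans (agree p′) e)))
                                           (λ e → new p′ (from (K (m<n⇒m<1+n p′) ≤-refl) e)))

sat-same-kernel : ∀ {B X φ g h} → Scoped B X → ScopedForm B φ → SameKernel B g h →
                  sat (ren g X) g φ → sat (ren h X) h φ
sat-same-kernel {B} {X} {φ} {h = h} sX sφ K s with kernel-bijection B K
... | π , agree =
  subst (λ Z → sat Z h φ) (trans (ren-∘ (λ _ → refl) X) (ren-agree agree sX))
        (to (sat-agree _ agree sφ) (sat-ren-↔ π φ (λ _ → refl) s))

⋀< : ℕ → (ℕ → Form) → Form
⋀< zero    f = tt
⋀< (suc n) f = ⋀< n f ∧ f n

sat-⋀< : ∀ {Z ρ} n f → sat Z ρ (⋀< n f) ⇔ (∀ {i} → i < n → sat Z ρ (f i))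
sat-⋀< zero    f = mk⇔ (λ _ ()) (λ _ → ⋆)
sat-⋀< {Z} {ρ} (suc n) f = mk⇔
  (λ (s , t) p → [ to (sat-⋀< n f) s , (λ { refl → t }) ]′ (m<1+n⇒m<n∨m≡n p))
  (λ (h : ∀ {i} → i < suc n → sat Z ρ (f i)) → from (sat-⋀< n f) (h ∘ m<n⇒m<1+n) , h ≤-refl)

kernel-atom : Ren → ℕ → ℕ → Form
kernel-atom g x y with g x ≟ g y
... | yes _ = x ≐ y
... | no _  = (x ≐ y) ⊃ ff

kernel-atom-self : ∀ {Z} g x y → sat Z g (kernel-atom g x y)
kernel-atom-self g x y with g x ≟ g y
... | yes e = e
... | no ¬e = ¬e

kernel-atom-sat : ∀ {Z h} g x y → sat Z h (kernel-atom g x y) → (g x ≡ g y) ⇔ (h x ≡ h y)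
kernel-atom-sat g x y s with g x ≟ g y
... | yes e = mk⇔ (λ _ → s) (λ _ → e)
... | no ¬e = mk⇔ (⊥-elim ∘ ¬e) (⊥-elim ∘ s)

kernel : Ren → ℕ → Form
kernel g n = ⋀< n λ x → ⋀< n λ y → kernel-atom g x y

kernel-self : ∀ {Z} g n → sat Z g (kernel g n)
kernel-self g n = from (sat-⋀< n _) λ _ → from (sat-⋀< n _) λ _ → kernel-atom-self g _ _

sat-kernel : ∀ {Z h} g n → sat Z h (kernel g n) → SameKernel n g h
sat-kernel g n s p q = kernel-atom-sat g _ _ (to (sat-⋀< n _) (to (sat-⋀< n _) s p) q)

⊨-unfold : ∀ {P φ} → (P ⊨ φ) ⇔ (∀ σ → sat (ren σ P) σ φ)
⊨-unfold {P} {φ} = mk⇔ (λ h σ → to (sat-renF (λ _ → refl) (ren σ P) φ) (h σ))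
                       (λ h σ → from (sat-renF (λ _ → refl) (ren σ P) φ) (h σ))

-- agrees with σ below N and, unlike σ, reaches every name: cover σ N (N + m) = m
cover : Ren → ℕ → Ren
cover σ N x with x <? N
... | yes _ = σ x
... | no _  = x ∸ N

cover-below : ∀ {σ N x} → x < N → cover σ N x ≡ σ x
cover-below {N = N} {x} p with x <? N
... | yes _ = refl
... | no ¬p = ⊥-elim (¬p p)

cover-shift : ∀ σ N m → cover σ N (N + m) ≡ m
cover-shift σ N m with N + m <? N
... | yes p = ⊥-elim (<⇒≱ p (m≤m+n N m))
... | no _  = m+n∸m≡n N m

distinction-lifts : ∀ P Q σ → Dist (ren σ P) (ren σ Q) → ∃ λ ψ → (P ⊨ ψ) × ¬ (Q ⊨ ψ)
distinction-lifts P Q σ (φ , Pσ⊨φ , Qσ⊭φ)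
  with bound₂ Scoped-mono Scoped-mono _,_ (scoped-bound P) (scoped-bound Q) | scopedForm-bound φ
... | N , sP , sQ | M , sφ = ψ , P⊨ψ , Q⊭ψ
  where
  g : Ren
  g = cover σ N

  χ ψ : Form
  χ = renF (N +_) φ
  ψ = kernel g (N + M) ⊃ χ

  χ⇔φ : ∀ Z → sat Z g χ ⇔ (Z ⊨̇ φ)
  χ⇔φ Z = sat-renF (cover-shift σ N) Z φ

  σ-as-g : ∀ {X} → Scoped N X → ren σ X ≡ ren g X
  σ-as-g = ren-agree (sym ∘ cover-below)

  P⊨ψ : P ⊨ ψ
  P⊨ψ = from (⊨-unfold {P} {ψ}) λ _ k →
    sat-same-kernel (Scoped-mono (m≤m+n N M) sP) (ScopedForm-renF (+-monoʳ-< N) sφ)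
                    (sat-kernel g (N + M) k) (from (χ⇔φ _) (subst (_⊨̇ φ) (σ-as-g sP) Pσ⊨φ))

  Q⊭ψ : ¬ (Q ⊨ ψ)
  Q⊭ψ h = Qσ⊭φ (subst (_⊨̇ φ) (sym (σ-as-g sQ))
                      (to (χ⇔φ _) (to (⊨-unfold {Q} {ψ}) h g (kernel-self g (N + M)))))

∼L-sym : ∀ {P Q} → P ∼L Q → Q ∼L P
∼L-sym (R , B , related) = R , B , LateBisim.symm B ∘ related

∼L⇒⊨ : ∀ {P Q} → P ∼L Q → ∀ φ → P ⊨ φ → Q ⊨ φ
∼L⇒⊨ (R , B , related) φ h σ = late-bisim-sat B (related σ) id (renF σ φ) (h σ)

⊨⇒∼L : ∀ {P Q} → (∀ φ → P ⊨ φ → Q ⊨ φ) → P ∼L Q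
⊨⇒∼L {P} {Q} H = LogEq , logEq-bisim , λ σ → [ id , contradiction σ ]′ (decide (ren σ P) (ren σ Q))
  where
  contradiction : ∀ σ → Dist (ren σ P) (ren σ Q) → LogEq (ren σ P) (ren σ Q)
  contradiction σ d with distinction-lifts P Q σ d
  ... | ψ , P⊨ψ , Q⊭ψ = ⊥-elim (Q⊭ψ (H ψ P⊨ψ))

corollary2 : ∀ (P Q : Proc) → (P ∼L Q) ⇔ (∀ (φ : Form) → (P ⊨ φ) ⇔ (Q ⊨ φ))
corollary2 P Q = mk⇔ (λ P∼Q φ → mk⇔ (∼L⇒⊨ P∼Q φ) (∼L⇒⊨ (∼L-sym P∼Q) φ))
                     (λ H → ⊨⇒∼L (λ φ → to (H φ)))
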